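{- Let $f:\{0,1\}^n\to\{0,1\}$ be a partial function. Then $\mathrm{RS}(f)\ge\mathrm{RC}(f)/4$.
   Context: Partial means $f$ is defined on a subset $\mathrm{Dom}(f)\subseteq\{0,1\}^n$. For $x\in\{0,1\}^n$ and a block $B\subseteq[n]$, $x^B$ is $x$ with the bits in $B$ flipped; $B$ is a sensitive block of $x$ if $x,x^B\in\mathrm{Dom}(f)$ and $f(x)\ne f(x^B)$. $\mathrm{RC}_x(f)$ is the maximum total weight of an assignment of non-negative weights to the sensitive blocks of $x$ such that for every $i\in[n]$ the total weight of blocks containing $i$ is at most $1$; $\mathrm{RC}(f)=\max_{x\in\mathrm{Dom}(f)}\mathrm{RC}_x(f)$. A randomized query algorithm is a probability distribution over deterministic decision trees; $\mathrm{R}_0(h)$ is the minimum, over randomized algorithms always correct on every input in the domain of $h$, of the maximum over inputs of the expected number of queries. Query notions apply to alphabet $\{0,1,*,\dagger\}$. Sabotage: $P_f\subseteq\{0,1,*\}^n$ is the set of $p$ for which there exist $x,y\in\mathrm{Dom}(f)$ with $f(x)\ne f(y)$ and $x_i=y_i=p_i$ whenever $p_i\ne*$; $P_f^\dagger$ is the same with $\dagger$ in place of $*$; $Q_f=P_f\cup P_f^\dagger$; $f_{\mathrm{sab}}:Q_f\to\{0,1\}$ is $0$ on $P_f$ and $1$ on $P_f^\dagger$; $\mathrm{RS}(f)=\mathrm{R}_0(f_{\mathrm{sab}})$. -}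

module Defs where

open import Data.Bool using (Bool; true; false; _xor_; if_then_else_)
open import Data.Nat using (ℕ; zero; suc)
open import Data.Fin using (Fin)
open import Data.Vec using (Vec; []; _∷_; lookup; zipWith)
open import Data.List using (List; []; _∷_; _++_; map; foldr)
open import Data.Maybe using (Maybe; just; nothing)
open import Data.Product using (Σ; _×_; _,_; proj₁; proj₂)
open import Data.Sum using (_⊎_)
open import Data.Integer using (+_)
open import Data.Rational using (ℚ; 0ℚ; _+_; _*_; _/_; _≤_)
open import Relation.Binary.PropositionalEquality using (_≡_; _≢_)
import Data.List.Membership.Propositional
import Data.Bool
open import Relation.Nullary using (Dec; yes; no; does)
open import Data.Bool.Properties using () renaming (_≟_ to _≟B_)

-- A partial Boolean function on {0,1}^n: nothing = outside the domain.
Partial : ℕ → Set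
Partial n = Vec Bool n → Maybe Bool

InDom : ∀ {n} → Partial n → Vec Bool n → Set
InDom f x = Σ Bool λ b → f x ≡ just b

-- all vectors in {0,1}^n (used both for inputs and for blocks B ⊆ [n],
-- a block being its characteristic vector)
allVecs : (n : ℕ) → List (Vec Bool n)
allVecs zero = [] ∷ []
allVecs (suc n) = map (false ∷_) (allVecs n) ++ map (true ∷_) (allVecs n)

flipBlock : ∀ {n} → Vec Bool n → Vec Bool n → Vec Bool n
flipBlock x B = zipWith _xor_ x B

sensitive : ∀ {n} → Partial n → Vec Bool n → Vec Bool n → Bool
sensitive f x B with f x | f (flipBlock x B)
... | just a | just b = Data.Bool.not (does (a ≟B b))
... | _ | _ = false

qsum : List ℚ → ℚ
qsum = foldr _+_ 0ℚ

natℚ : ℕ → ℚ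
natℚ k = + k / 1

totalWeight : ∀ {n} → Partial n → Vec Bool n → (Vec Bool n → ℚ) → ℚ
totalWeight {n} f x w =
  qsum (map (λ B → if sensitive f x B then w B else 0ℚ) (allVecs n))

weightAt : ∀ {n} → Partial n → Vec Bool n → (Vec Bool n → ℚ) → Fin n → ℚ
weightAt {n} f x w i =
  qsum (map (λ B → if sensitive f x B then (if lookup B i then w B else 0ℚ) else 0ℚ)
            (allVecs n))

-- feasible fractional block weighting for RC_x(f)
FeasibleWeighting : ∀ {n} → Partial n → Vec Bool n → (Vec Bool n → ℚ) → Set
FeasibleWeighting {n} f x w =
  (∀ B → 0ℚ ≤ w B) × (∀ (i : Fin n) → weightAt f x w i ≤ Data.Rational.1ℚ)

data Sym : Set where
  s0 s1 star dagger : Sym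

bitSym : Bool → Sym
bitSym false = s0
bitSym true = s1

InP : ∀ {n} → Partial n → Sym → Vec Sym n → Set
InP {n} f c p =
  (∀ (i : Fin n) → lookup p i ≡ bitSym false ⊎ lookup p i ≡ bitSym true ⊎ lookup p i ≡ c) ×
  Σ (Vec Bool n) λ x → Σ (Vec Bool n) λ y → Σ Bool λ a → Σ Bool λ b →
    f x ≡ just a × f y ≡ just b × a ≢ b ×
    (∀ (i : Fin n) → lookup p i ≡ c ⊎
        (lookup p i ≡ bitSym (lookup x i) × lookup p i ≡ bitSym (lookup y i)))

P-f : ∀ {n} → Partial n → Vec Sym n → Set
P-f f = InP f star

P-f† : ∀ {n} → Partial n → Vec Sym n → Set
P-f† f = InP f dagger

Q-f : ∀ {n} → Partial n → Vec Sym n → Set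
Q-f f p = P-f f p ⊎ P-f† f p

data DT (n : ℕ) : Set where
  leaf  : Bool → DT n
  query : Fin n → (Sym → DT n) → DT n

runDT : ∀ {n} → DT n → Vec Sym n → Bool
runDT (leaf b) p = b
runDT (query i k) p = runDT (k (lookup p i)) p

queries : ∀ {n} → DT n → Vec Sym n → ℕ
queries (leaf b) p = zero
queries (query i k) p = suc (queries (k (lookup p i)) p)

-- tree computes f_sab correctly on all of Q_f (0 on P_f, 1 on P_f^†)
CorrectSab : ∀ {n} → Partial n → DT n → Set
CorrectSab f t =
  (∀ p → P-f f p → runDT t p ≡ false) × (∀ p → P-f† f p → runDT t p ≡ true)

RandAlg : ℕ → Set
RandAlg n = List (ℚ × DT n)

IsDistribution : ∀ {n} → RandAlg n → Set
IsDistribution R =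
  (∀ {e} → e Data.List.Membership.Propositional.∈ R → 0ℚ ≤ proj₁ e) ×
  qsum (map proj₁ R) ≡ Data.Rational.1ℚ

ZeroErrorSab : ∀ {n} → Partial n → RandAlg n → Set
ZeroErrorSab f R = ∀ {e} → e Data.List.Membership.Propositional.∈ R → CorrectSab f (proj₂ e)

expectedQueries : ∀ {n} → RandAlg n → Vec Sym n → ℚ
expectedQueries R p = qsum (map (λ e → proj₁ e * natℚ (queries (proj₂ e) p)) R)

{-# OPTIONS --safe #-}
module Submission where

-- Fix x and a feasible weighting w of its sensitive blocks, of total weight W.
-- For a sensitive block B let p_B be x with the bits in B replaced by *; it lies
-- in P_f, and with † instead of * it lies in P_f^†.  Both agree with x outside B,
-- so every zero-error tree queries a position of B on p_B.  Let h_T(B) count the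
-- queries along the path of x up to the first one inside B.  If T first queries
-- i, the blocks containing i weigh a ≤ 1 and the others W′, so induction on T,
-- using (a + W′)² ≤ 2(a + W′) + W′², gives W² ≤ 2 Σ_B w_B h_T(B).  Averaging
-- over the algorithm, W² ≤ 2 Σ_B w_B E_B with E_B the expected cost on p_B; if
-- 4 E_B < W for every sensitive B this yields 2W² ≤ W², so W ≤ 0.

open import Defs
open import Data.Nat using (ℕ)
open import Data.Bool using (Bool)
open import Data.Vec using (Vec)
open import Data.Product using (Σ; _×_)
open import Data.Sum using (_⊎_)
open import Data.Rational using (ℚ; 0ℚ; _≤_; _*_)

open import Data.Nat as ℕ using (zero; suc; z≤n; s≤s)
open import Data.Bool using (true; false; if_then_else_; _∨_; _xor_)
open import Data.Bool.Properties using (if-swap-then; not-¬) renaming (_≟_ to _≟B_)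
open import Data.Fin using (Fin)
open import Data.Vec using (lookup; tabulate)
open import Data.Vec.Properties using (lookup∘tabulate; lookup-zipWith)
open import Data.List using (List; []; _∷_; map)
open import Data.List.Relation.Unary.All as All using (All; []; _∷_)
open import Data.List.Relation.Unary.All.Properties using (¬Any⇒All¬)
open import Data.List.Relation.Unary.Any using (Any; any?; satisfied)
open import Data.Product using (_,_; proj₁; proj₂)
open import Data.Sum using (inj₁; inj₂; map₂)
open import Data.Maybe using (just)
open import Data.Empty using (⊥-elim)
open import Relation.Nullary using (¬_; Dec; yes; no)
open import Relation.Nullary.Decidable using (_×-dec_)
open import Relation.Binary.PropositionalEquality
import Data.Integer as ℤ
import Data.Integer.Properties as ℤ
import Data.Nat.Coprimality as Coprime
open import Data.Rational using (1ℚ; _+_; _<_; _/_; mkℚ; *≤*; Positive; nonNegative; positive)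
open import Data.Rational.Properties
  using (≤-refl; ≤-reflexive; ≤-trans; <-irrefl; _≤?_; ≰⇒>; <⇒≤; +-mono-≤; +-monoʳ-≤; +-monoʳ-<;
         *-monoˡ-≤-nonNeg; *-monoʳ-≤-nonNeg; +-identityˡ; +-identityʳ; *-identityˡ; *-identityʳ;
         *-zeroˡ; *-zeroʳ; *-distribˡ-+; *-comm; normalize-coprime; pos*pos⇒pos; positive⁻¹;
         module ≤-Reasoning)
open import Data.Rational.Solver using (module +-*-Solver)
open +-*-Solver

natℚ≡mkℚ : ∀ k → natℚ k ≡ mkℚ (ℤ.+ k) 0 (Coprime.sym (Coprime.1-coprimeTo k))
natℚ≡mkℚ k = normalize-coprime _

natℚ-suc : ∀ k → natℚ (suc k) ≡ 1ℚ + natℚ k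
natℚ-suc k rewrite natℚ≡mkℚ k = cong (λ m → (ℤ.+ 1 ℤ.+ m) / 1) (sym (ℤ.*-identityʳ (ℤ.+ k)))

natℚ-mono-≤ : ∀ {m k} → m ℕ.≤ k → natℚ m ≤ natℚ k
natℚ-mono-≤ {m} {k} m≤k rewrite natℚ≡mkℚ m | natℚ≡mkℚ k =
  *≤* (subst₂ ℤ._≤_ (sym (ℤ.*-identityʳ (ℤ.+ m))) (sym (ℤ.*-identityʳ (ℤ.+ k))) (ℤ.+≤+ m≤k))

∑ : {A : Set} → List A → (A → ℚ) → ℚ
∑ L g = qsum (map g L)

infix 5 ∑
syntax ∑ L (λ a → g) = ∑[ a ∈ L ] g

private variable A A′ : Set

∑-cong : (L : List A) {g h : A → ℚ} → (∀ a → g a ≡ h a) → ∑ L g ≡ ∑ L h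
∑-cong []      g≡h = refl
∑-cong (a ∷ L) g≡h = cong₂ _+_ (g≡h a) (∑-cong L g≡h)

∑-zero : (L : List A) → ∑[ _ ∈ L ] 0ℚ ≡ 0ℚ
∑-zero []      = refl
∑-zero (a ∷ L) = trans (+-identityˡ _) (∑-zero L)

∑-+ : (L : List A) (g h : A → ℚ) → (∑[ a ∈ L ] g a + h a) ≡ ∑ L g + ∑ L h
∑-+ []      g h = sym (+-identityʳ 0ℚ)
∑-+ (a ∷ L) g h = trans (cong ((g a + h a) +_) (∑-+ L g h)) (interchange (g a) (h a) (∑ L g) (∑ L h))
  where
  interchange : ∀ p q r s → (p + q) + (r + s) ≡ (p + r) + (q + s)
  interchange = solve 4 (λ p q r s → (p :+ q) :+ (r :+ s) := (p :+ r) :+ (q :+ s)) refl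

∑-*ˡ : (L : List A) (c : ℚ) (g : A → ℚ) → (∑[ a ∈ L ] c * g a) ≡ c * ∑ L g
∑-*ˡ []      c g = sym (*-zeroʳ c)
∑-*ˡ (a ∷ L) c g = trans (cong ((c * g a) +_) (∑-*ˡ L c g)) (sym (*-distribˡ-+ c _ _))

∑-mono-≤ : (L : List A) {g h : A → ℚ} → All (λ a → g a ≤ h a) L → ∑ L g ≤ ∑ L h
∑-mono-≤ []      []          = ≤-refl
∑-mono-≤ (a ∷ L) (g≤h ∷ gs≤hs) = +-mono-≤ g≤h (∑-mono-≤ L gs≤hs)

∑-nonNeg : (L : List A) {g : A → ℚ} → All (λ a → 0ℚ ≤ g a) L → 0ℚ ≤ ∑ L g
∑-nonNeg L {g} g≥0 = subst (_≤ ∑ L g) (∑-zero L) (∑-mono-≤ L g≥0)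

∑-comm : (L : List A) (M : List A′) (g : A → A′ → ℚ) →
         (∑[ a ∈ L ] ∑[ b ∈ M ] g a b) ≡ (∑[ b ∈ M ] ∑[ a ∈ L ] g a b)
∑-comm []      M g = sym (∑-zero M)
∑-comm (a ∷ L) M g =
  trans (cong (∑ M (g a) +_) (∑-comm L M g)) (sym (∑-+ M (g a) (λ b → ∑[ a ∈ L ] g a b)))

∑-weighted-comm : (L : List A) (M : List A′) (r : A → ℚ) (u : A′ → ℚ) (h : A → A′ → ℚ) →
                  (∑[ a ∈ L ] r a * (∑[ b ∈ M ] u b * h a b)) ≡ (∑[ b ∈ M ] u b * (∑[ a ∈ L ] r a * h a b))
∑-weighted-comm L M r u h = begin
  (∑[ a ∈ L ] r a * (∑[ b ∈ M ] u b * h a b))   ≡⟨ ∑-cong L (λ a → ∑-*ˡ M (r a) _) ⟨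
  (∑[ a ∈ L ] ∑[ b ∈ M ] r a * (u b * h a b))   ≡⟨ ∑-comm L M _ ⟩
  (∑[ b ∈ M ] ∑[ a ∈ L ] r a * (u b * h a b))   ≡⟨ ∑-cong M (λ b → ∑-cong L (λ a → exchange (r a) (u b) (h a b))) ⟩
  (∑[ b ∈ M ] ∑[ a ∈ L ] u b * (r a * h a b))   ≡⟨ ∑-cong M (λ b → ∑-*ˡ L (u b) _) ⟩
  (∑[ b ∈ M ] u b * (∑[ a ∈ L ] r a * h a b))   ∎
  where
  open ≡-Reasoning
  exchange : ∀ p q s → p * (q * s) ≡ q * (p * s)
  exchange = solve 3 (λ p q s → p :* (q :* s) := q :* (p :* s)) refl

≤-weighted-mean : (L : List A) {r g : A → ℚ} {c : ℚ} → All (λ a → 0ℚ ≤ r a) L → ∑ L r ≡ 1ℚ →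
                  All (λ a → c ≤ g a) L → c ≤ ∑[ a ∈ L ] r a * g a
≤-weighted-mean L {r} {g} {c} r≥0 ∑r≡1 c≤g = begin
  c                    ≡⟨ *-identityʳ c ⟨
  c * 1ℚ               ≡⟨ cong (c *_) ∑r≡1 ⟨
  c * ∑ L r            ≡⟨ ∑-*ˡ L c r ⟨
  (∑[ a ∈ L ] c * r a) ≡⟨ ∑-cong L (λ a → *-comm c (r a)) ⟩
  (∑[ a ∈ L ] r a * c) ≤⟨ ∑-mono-≤ L (All.zipWith scale (r≥0 , c≤g)) ⟩
  (∑[ a ∈ L ] r a * g a) ∎
  where
  open ≤-Reasoning
  scale : ∀ {a} → 0ℚ ≤ r a × c ≤ g a → r a * c ≤ r a * g a
  scale {a} (ra≥0 , c≤ga) = *-monoˡ-≤-nonNeg (r a) {{nonNegative ra≥0}} c≤ga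

square-step : ∀ {a b s} → 0ℚ ≤ a → a ≤ 1ℚ → 0ℚ ≤ b → b * b ≤ s + s →
              (a + b) * (a + b) ≤ (a + b + s) + (a + b + s)
square-step {a} {b} {s} a≥0 a≤1 b≥0 b²≤2s = begin
  (a + b) * (a + b)                ≡⟨ expand a b ⟩
  a * a + (a * b + a * b) + b * b  ≤⟨ +-mono-≤ (+-mono-≤ a²≤a (+-mono-≤ ab≤b ab≤b)) b²≤2s ⟩
  a + (b + b) + (s + s)            ≡⟨ +-identityʳ _ ⟨
  a + (b + b) + (s + s) + 0ℚ       ≤⟨ +-monoʳ-≤ (a + (b + b) + (s + s)) a≥0 ⟩
  a + (b + b) + (s + s) + a        ≡⟨ regroup a b s ⟩
  (a + b + s) + (a + b + s)        ∎
  where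
  open ≤-Reasoning
  a²≤a : a * a ≤ a
  a²≤a = ≤-trans (*-monoˡ-≤-nonNeg a {{nonNegative a≥0}} a≤1) (≤-reflexive (*-identityʳ a))
  ab≤b : a * b ≤ b
  ab≤b = ≤-trans (*-monoʳ-≤-nonNeg b {{nonNegative b≥0}} a≤1) (≤-reflexive (*-identityˡ b))
  expand : ∀ a b → (a + b) * (a + b) ≡ a * a + (a * b + a * b) + b * b
  expand = solve 2 (λ a b → (a :+ b) :* (a :+ b) := a :* a :+ (a :* b :+ a :* b) :+ b :* b) refl
  regroup : ∀ a b s → a + (b + b) + (s + s) + a ≡ (a + b + s) + (a + b + s)
  regroup = solve 3 (λ a b s → a :+ (b :+ b) :+ (s :+ s) :+ a := (a :+ b :+ s) :+ (a :+ b :+ s)) refl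

square-squeeze : ∀ {W X} → W * W ≤ X + X → natℚ 4 * X ≤ W * W → W ≤ 0ℚ
square-squeeze {W} {X} W²≤2X 4X≤W² with W ≤? 0ℚ
... | yes W≤0 = W≤0
... | no  W≰0 = ⊥-elim (<-irrefl refl (begin-strict
  W * W              ≡⟨ +-identityʳ (W * W) ⟨
  W * W + 0ℚ         <⟨ +-monoʳ-< (W * W) W²>0 ⟩
  W * W + W * W      ≤⟨ +-mono-≤ W²≤2X W²≤2X ⟩
  (X + X) + (X + X)  ≡⟨ quadruple X ⟨
  natℚ 4 * X         ≤⟨ 4X≤W² ⟩
  W * W              ∎))
  where
  open ≤-Reasoning
  instance
    W-pos : Positive W
    W-pos = positive (≰⇒> W≰0)
  W²>0 : 0ℚ < W * W
  W²>0 = positive⁻¹ (W * W) {{pos*pos⇒pos W W}}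
  quadruple : ∀ X → natℚ 4 * X ≡ (X + X) + (X + X)
  quadruple = solve 1 (λ X → con (natℚ 4) :* X := (X :+ X) :+ (X :+ X)) refl

sensitive⇒values : ∀ {n} (f : Partial n) (x B : Vec Bool n) → sensitive f x B ≡ true →
                   Σ Bool λ a → Σ Bool λ b → f x ≡ just a × f (flipBlock x B) ≡ just b × a ≢ b
sensitive⇒values f x B s with f x | f (flipBlock x B)
... | just a | just b with a ≟B b
...   | no a≢b = a , b , refl , refl , a≢b

module Path {n : ℕ} (x : Vec Bool n) where

  x̂ : Fin n → Sym
  x̂ i = bitSym (lookup x i)

  sabotage : Sym → Vec Bool n → Vec Sym n
  sabotage c B = tabulate (λ i → if lookup B i then c else x̂ i)

  lookup-sabotage : ∀ c B i → lookup (sabotage c B) i ≡ (if lookup B i then c else x̂ i)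
  lookup-sabotage c B i = lookup∘tabulate _ i

  touches : DT n → Vec Bool n → Bool
  touches (leaf _)    B = false
  touches (query i k) B = lookup B i ∨ touches (k (x̂ i)) B

  hitTime : DT n → Vec Bool n → ℕ
  hitTime (leaf _)    B = zero
  hitTime (query i k) B = suc (if lookup B i then zero else hitTime (k (x̂ i)) B)

  hitTime≤queries : ∀ T B → hitTime T B ℕ.≤ queries T (sabotage star B)
  hitTime≤queries (leaf _)    B = z≤n
  hitTime≤queries (query i k) B rewrite lookup-sabotage star B i with lookup B i
  ... | true  = s≤s z≤n
  ... | false = s≤s (hitTime≤queries (k (x̂ i)) B)

  untouched⇒star≡dagger : ∀ T B → touches T B ≡ false →
                          runDT T (sabotage star B) ≡ runDT T (sabotage dagger B)
  untouched⇒star≡dagger (leaf _)    B _ = refl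
  untouched⇒star≡dagger (query i k) B
    rewrite lookup-sabotage star B i | lookup-sabotage dagger B i with lookup B i
  ... | true  = λ ()
  ... | false = untouched⇒star≡dagger (k (x̂ i)) B

  sabotage-∈P : (f : Partial n) (c : Sym) (B : Vec Bool n) → sensitive f x B ≡ true →
                InP f c (sabotage c B)
  sabotage-∈P f c B s with sensitive⇒values f x B s
  ... | a , b , fx≡a , fxᴮ≡b , a≢b = symbols , x , flipBlock x B , a , b , fx≡a , fxᴮ≡b , a≢b , agrees
    where
    symbols : ∀ i → lookup (sabotage c B) i ≡ bitSym false ⊎ lookup (sabotage c B) i ≡ bitSym true
                    ⊎ lookup (sabotage c B) i ≡ c
    symbols i rewrite lookup-sabotage c B i with lookup B i | lookup x i
    ... | true  | _     = inj₂ (inj₂ refl)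
    ... | false | false = inj₁ refl
    ... | false | true  = inj₂ (inj₁ refl)
    agrees : ∀ i → lookup (sabotage c B) i ≡ c ⊎
             (lookup (sabotage c B) i ≡ bitSym (lookup x i) ×
              lookup (sabotage c B) i ≡ bitSym (lookup (flipBlock x B) i))
    agrees i rewrite lookup-sabotage c B i | lookup-zipWith _xor_ i x B with lookup B i | lookup x i
    ... | true  | _     = inj₁ refl
    ... | false | false = inj₂ (refl , refl)
    ... | false | true  = inj₂ (refl , refl)

  correct⇒touches : (f : Partial n) (T : DT n) (B : Vec Bool n) → CorrectSab f T →
                    sensitive f x B ≡ true → touches T B ≡ true
  correct⇒touches f T B (on-P , on-P†) s with touches T B in untouched
  ... | true  = refl
  ... | false with trans (sym (on-P _ (sabotage-∈P f star B s)))
                   (trans (untouched⇒star≡dagger T B untouched) (on-P† _ (sabotage-∈P f dagger B s)))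
  ...   | ()

module HitTimeBound {n : ℕ} (x : Vec Bool n) (L : List (Vec Bool n)) where
  open Path x

  inside outside : Fin n → (Vec Bool n → ℚ) → Vec Bool n → ℚ
  inside  i u B = if lookup B i then u B else 0ℚ
  outside i u B = if lookup B i then 0ℚ else u B

  load : Fin n → (Vec Bool n → ℚ) → ℚ
  load i u = ∑ L (inside i u)

  cost : DT n → (Vec Bool n → ℚ) → ℚ
  cost T u = ∑[ B ∈ L ] u B * natℚ (hitTime T B)

  inside-nonNeg : ∀ i {u} → (∀ B → 0ℚ ≤ u B) → ∀ B → 0ℚ ≤ inside i u B
  inside-nonNeg i u≥0 B with lookup B i
  ... | true  = u≥0 B
  ... | false = ≤-refl

  outside-nonNeg : ∀ i {u} → (∀ B → 0ℚ ≤ u B) → ∀ B → 0ℚ ≤ outside i u B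
  outside-nonNeg i u≥0 B with lookup B i
  ... | true  = ≤-refl
  ... | false = u≥0 B

  inside-outside≤inside : ∀ i j {u} → (∀ B → 0ℚ ≤ u B) → ∀ B → inside j (outside i u) B ≤ inside j u B
  inside-outside≤inside i j u≥0 B with lookup B j | lookup B i
  ... | true  | true  = u≥0 B
  ... | true  | false = ≤-refl
  ... | false | _     = ≤-refl

  outside-supported : ∀ i k {u} → (∀ B → touches (query i k) B ≡ false → u B ≡ 0ℚ) →
                      ∀ B → touches (k (x̂ i)) B ≡ false → outside i u B ≡ 0ℚ
  outside-supported i k supp B with lookup B i | supp B
  ... | true  | _       = λ _ → refl
  ... | false | supp-B  = supp-B

  ∑-split : ∀ i u → ∑ L u ≡ load i u + ∑ L (outside i u)
  ∑-split i u = trans (∑-cong L split) (∑-+ L (inside i u) (outside i u))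
    where
    split : ∀ B → u B ≡ inside i u B + outside i u B
    split B with lookup B i
    ... | true  = sym (+-identityʳ (u B))
    ... | false = sym (+-identityˡ (u B))

  cost-query : ∀ i k u → cost (query i k) u ≡ load i u + ∑ L (outside i u) + cost (k (x̂ i)) (outside i u)
  cost-query i k u = begin
    cost (query i k) u
      ≡⟨ ∑-cong L (λ B → trans (cong (u B *_) (natℚ-suc (rest B))) (*-distribˡ-+ (u B) 1ℚ (natℚ (rest B)))) ⟩
    (∑[ B ∈ L ] u B * 1ℚ + u B * natℚ (rest B))
      ≡⟨ ∑-cong L (λ B → cong₂ _+_ (*-identityʳ (u B)) (pass B)) ⟩
    (∑[ B ∈ L ] u B + outside i u B * natℚ (hitTime T′ B))
      ≡⟨ ∑-+ L u _ ⟩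
    ∑ L u + cost T′ (outside i u)
      ≡⟨ cong (_+ cost T′ (outside i u)) (∑-split i u) ⟩
    load i u + ∑ L (outside i u) + cost T′ (outside i u) ∎
    where
    open ≡-Reasoning
    T′ = k (x̂ i)
    rest : Vec Bool n → ℕ
    rest B = if lookup B i then zero else hitTime T′ B
    pass : ∀ B → u B * natℚ (rest B) ≡ outside i u B * natℚ (hitTime T′ B)
    pass B with lookup B i
    ... | true  = trans (*-zeroʳ (u B)) (sym (*-zeroˡ (natℚ (hitTime T′ B))))
    ... | false = refl

  hitTime-bound : ∀ T u → (∀ B → 0ℚ ≤ u B) → (∀ i → load i u ≤ 1ℚ) →
                  (∀ B → touches T B ≡ false → u B ≡ 0ℚ) →
                  ∑ L u * ∑ L u ≤ cost T u + cost T u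
  hitTime-bound (leaf b) u _ _ supp =
    subst₂ (λ W c → W * W ≤ c + c) (sym no-weight) (sym no-cost) ≤-refl
    where
    no-weight : ∑ L u ≡ 0ℚ
    no-weight = trans (∑-cong L (λ B → supp B refl)) (∑-zero L)
    no-cost : cost (leaf b) u ≡ 0ℚ
    no-cost = trans (∑-cong L (λ B → *-zeroʳ (u B))) (∑-zero L)
  hitTime-bound (query i k) u u≥0 load≤1 supp = begin
    ∑ L u * ∑ L u                ≡⟨ cong (λ W → W * W) (∑-split i u) ⟩
    (a + W′) * (a + W′)          ≤⟨ square-step a≥0 (load≤1 i) W′≥0 W′²≤2S′ ⟩
    (a + W′ + S′) + (a + W′ + S′) ≡⟨ cong (λ c → c + c) (cost-query i k u) ⟨
    cost (query i k) u + cost (query i k) u ∎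
    where
    open ≤-Reasoning
    T′ = k (x̂ i)
    a  = load i u
    W′ = ∑ L (outside i u)
    S′ = cost T′ (outside i u)
    a≥0 : 0ℚ ≤ a
    a≥0 = ∑-nonNeg L (All.universal (inside-nonNeg i u≥0) L)
    W′≥0 : 0ℚ ≤ W′
    W′≥0 = ∑-nonNeg L (All.universal (outside-nonNeg i u≥0) L)
    W′²≤2S′ : W′ * W′ ≤ S′ + S′
    W′²≤2S′ = hitTime-bound (k (x̂ i)) (outside i u) (outside-nonNeg i u≥0)
      (λ j → ≤-trans (∑-mono-≤ L (All.universal (inside-outside≤inside i j u≥0) L)) (load≤1 j))
      (outside-supported i k supp)

  expectedSabotageCost : RandAlg n → (Vec Bool n → ℚ) → ℚ
  expectedSabotageCost R u = ∑[ B ∈ L ] u B * expectedQueries R (sabotage star B)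

  average-cost≤ : (R : RandAlg n) {u : Vec Bool n → ℚ} → All (λ e → 0ℚ ≤ proj₁ e) R → (∀ B → 0ℚ ≤ u B) →
                  (∑[ e ∈ R ] proj₁ e * cost (proj₂ e) u) ≤ expectedSabotageCost R u
  average-cost≤ R {u} r≥0 u≥0 = begin
    (∑[ e ∈ R ] proj₁ e * cost (proj₂ e) u)
      ≡⟨ ∑-weighted-comm R L proj₁ u (λ e B → natℚ (hitTime (proj₂ e) B)) ⟩
    (∑[ B ∈ L ] u B * (∑[ e ∈ R ] proj₁ e * natℚ (hitTime (proj₂ e) B)))
      ≤⟨ ∑-mono-≤ L (All.universal (λ B → *-monoˡ-≤-nonNeg (u B) {{nonNegative (u≥0 B)}}
           (∑-mono-≤ R (All.map (λ {e} re≥0 → *-monoˡ-≤-nonNeg (proj₁ e) {{nonNegative re≥0}}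
             (natℚ-mono-≤ (hitTime≤queries (proj₂ e) B))) r≥0))) L) ⟩
    (∑[ B ∈ L ] u B * expectedQueries R (sabotage star B)) ∎
    where open ≤-Reasoning

  randomized-hitTime-bound : (R : RandAlg n) (u : Vec Bool n → ℚ) →
                             All (λ e → 0ℚ ≤ proj₁ e) R → ∑ R proj₁ ≡ 1ℚ →
                             (∀ B → 0ℚ ≤ u B) → (∀ i → load i u ≤ 1ℚ) →
                             All (λ e → ∀ B → touches (proj₂ e) B ≡ false → u B ≡ 0ℚ) R →
                             ∑ L u * ∑ L u ≤ expectedSabotageCost R u + expectedSabotageCost R u
  randomized-hitTime-bound R u r≥0 ∑r≡1 u≥0 load≤1 supp = begin
    ∑ L u * ∑ L u
      ≤⟨ ≤-weighted-mean R r≥0 ∑r≡1 (All.map (λ {e} → hitTime-bound (proj₂ e) u u≥0 load≤1) supp) ⟩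
    (∑[ e ∈ R ] proj₁ e * (cost (proj₂ e) u + cost (proj₂ e) u))
      ≡⟨ ∑-cong R (λ e → *-distribˡ-+ (proj₁ e) _ _) ⟩
    (∑[ e ∈ R ] proj₁ e * cost (proj₂ e) u + proj₁ e * cost (proj₂ e) u)
      ≡⟨ ∑-+ R _ _ ⟩
    (∑[ e ∈ R ] proj₁ e * cost (proj₂ e) u) + (∑[ e ∈ R ] proj₁ e * cost (proj₂ e) u)
      ≤⟨ +-mono-≤ (average-cost≤ R r≥0 u≥0) (average-cost≤ R r≥0 u≥0) ⟩
    expectedSabotageCost R u + expectedSabotageCost R u ∎
    where open ≤-Reasoning

module SensitiveWeighting {n : ℕ} (f : Partial n) (x : Vec Bool n) (w : Vec Bool n → ℚ) where
  open Path x
  open HitTimeBound x (allVecs n)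

  sensitiveWeight : Vec Bool n → ℚ
  sensitiveWeight B = if sensitive f x B then w B else 0ℚ

  sensitiveWeight-nonNeg : (∀ B → 0ℚ ≤ w B) → ∀ B → 0ℚ ≤ sensitiveWeight B
  sensitiveWeight-nonNeg w≥0 B with sensitive f x B
  ... | true  = w≥0 B
  ... | false = ≤-refl

  load-sensitiveWeight : ∀ i → load i sensitiveWeight ≡ weightAt f x w i
  load-sensitiveWeight i = ∑-cong (allVecs n) (λ B → sym (if-swap-then (sensitive f x B) (lookup B i)))

  sensitiveWeight-supported : ∀ T → CorrectSab f T → ∀ B → touches T B ≡ false → sensitiveWeight B ≡ 0ℚ
  sensitiveWeight-supported T T-correct B with sensitive f x B in sensitive-B
  ... | true  = λ untouched → ⊥-elim (not-¬ untouched (correct⇒touches f T B T-correct sensitive-B))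
  ... | false = λ _ → refl

  Witness : RandAlg n → Vec Bool n → Set
  Witness R B = sensitive f x B ≡ true × totalWeight f x w ≤ natℚ 4 * expectedQueries R (sabotage star B)

  witness? : ∀ R B → Dec (Witness R B)
  witness? R B = (sensitive f x B ≟B true) ×-dec (totalWeight f x w ≤? natℚ 4 * expectedQueries R (sabotage star B))

  no-witness⇒4·cost≤weight² : ∀ R → (∀ B → 0ℚ ≤ w B) → All (λ B → ¬ Witness R B) (allVecs n) →
                              natℚ 4 * expectedSabotageCost R sensitiveWeight ≤ totalWeight f x w * totalWeight f x w
  no-witness⇒4·cost≤weight² R w≥0 none = begin
    natℚ 4 * expectedSabotageCost R u         ≡⟨ ∑-*ˡ L (natℚ 4) (λ B → u B * E B) ⟨
    (∑[ B ∈ L ] natℚ 4 * (u B * E B))         ≤⟨ ∑-mono-≤ L (All.map bound none) ⟩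
    (∑[ B ∈ L ] u B * W)                      ≡⟨ ∑-cong L (λ B → *-comm (u B) W) ⟩
    (∑[ B ∈ L ] W * u B)                      ≡⟨ ∑-*ˡ L W u ⟩
    W * W                                      ∎
    where
    open ≤-Reasoning
    L = allVecs n
    u = sensitiveWeight
    W = totalWeight f x w
    E : Vec Bool n → ℚ
    E B = expectedQueries R (sabotage star B)
    exchange : ∀ p q s → p * (q * s) ≡ q * (p * s)
    exchange = solve 3 (λ p q s → p :* (q :* s) := q :* (p :* s)) refl
    bound : ∀ {B} → ¬ Witness R B → natℚ 4 * (u B * E B) ≤ u B * W
    bound {B} no-witness with sensitive f x B
    ... | true  = ≤-trans (≤-reflexive (exchange (natℚ 4) (w B) (E B)))
                   (*-monoˡ-≤-nonNeg (w B) {{nonNegative (w≥0 B)}} (<⇒≤ (≰⇒> (λ W≤4E → no-witness (refl , W≤4E)))))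
    ... | false = ≤-reflexive (begin-equality
      natℚ 4 * (0ℚ * E B) ≡⟨ cong (natℚ 4 *_) (*-zeroˡ (E B)) ⟩
      natℚ 4 * 0ℚ         ≡⟨ *-zeroʳ (natℚ 4) ⟩
      0ℚ                  ≡⟨ *-zeroˡ W ⟨
      0ℚ * W              ∎)

  null-or-witness : FeasibleWeighting f x w → (R : RandAlg n) → IsDistribution R → ZeroErrorSab f R →
                    totalWeight f x w ≤ 0ℚ ⊎ Any (Witness R) (allVecs n)
  null-or-witness (w≥0 , load≤1) R (r≥0 , ∑r≡1) zero-error with any? (witness? R) (allVecs n)
  ... | yes found = inj₂ found
  ... | no  none  = inj₁ (square-squeeze {X = expectedSabotageCost R sensitiveWeight}
    (randomized-hitTime-bound R sensitiveWeight (All.tabulate r≥0) ∑r≡1 (sensitiveWeight-nonNeg w≥0)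
      (λ i → subst (_≤ 1ℚ) (sym (load-sensitiveWeight i)) (load≤1 i))
      (All.tabulate (λ {e} e∈R → sensitiveWeight-supported (proj₂ e) (zero-error e∈R))))
    (no-witness⇒4·cost≤weight² R w≥0 (¬Any⇒All¬ (allVecs n) none)))

theorem31 : (n : ℕ) (f : Partial n) (x : Vec Bool n) → InDom f x →
              (w : Vec Bool n → ℚ) → FeasibleWeighting f x w →
              (R : RandAlg n) → IsDistribution R → ZeroErrorSab f R →
              totalWeight f x w ≤ 0ℚ ⊎
              Σ (Vec Sym n) (λ p → Q-f f p × totalWeight f x w ≤ natℚ 4 * expectedQueries R p)
theorem31 n f x _ w feasible R distribution zero-error =
  map₂ sabotaged-input (null-or-witness feasible R distribution zero-error)
  where
  open Path x
  open SensitiveWeighting f x w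
  sabotaged-input : Any (Witness R) (allVecs n) →
                    Σ (Vec Sym n) (λ p → Q-f f p × totalWeight f x w ≤ natℚ 4 * expectedQueries R p)
  sabotaged-input found with satisfied found
  ... | B , sensitive-B , W≤4E = sabotage star B , inj₁ (sabotage-∈P f star B sensitive-B) , W≤4E
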